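{- Let $n\ge1$ and let $\alpha=(\alpha_1,\ldots,\alpha_p)$ and $\beta=(\beta_1,\ldots,\beta_q)$ be partitions of $n$ with $\gcd(\alpha_1,\ldots,\alpha_p,\beta_1,\ldots,\beta_q)=1$. Then there exists a weighted tree with passport $(\alpha,\beta)$ if and only if $p+q\le n+1$.
   Context: A weighted tree is a finite bicolored plane tree with positive integer edge weights. Bicolored means that every vertex is black or white and every edge joins vertices of different colors. Plane means that a cyclic order of edges at each vertex is fixed. The degree of a vertex is the sum of the weights of its incident edges. The total weight $n$ is the sum of all edge weights. The passport is the pair of partitions of $n$ formed by the degrees of the black vertices and the degrees of the white vertices. -}

module Defs where

open import Data.Nat using (ℕ; zero; suc; _+_; _≤_)
open import Data.Nat.GCD using (gcd)
open import Data.List using (List; []; _∷_; _++_; length; foldr)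
open import Data.Nat.ListAction using (sum)
open import Data.List.Relation.Unary.All using (All)
open import Data.List.Relation.Binary.Permutation.Propositional using (_↭_)
open import Data.Product using (_×_)
open import Relation.Binary.PropositionalEquality using (_≡_)

-- Weighted bicolored plane trees, presented as rooted plane trees.  The linear order of
-- the children (after the parent edge) determines the cyclic order of edges
-- at every vertex; every weighted bicolored plane tree with at least one
-- edge is obtained this way by rooting it at a black vertex.
mutual
  data BVertex : Set where
    black : List WEdge → BVertex

  data WEdge : Set where
    edge : (w : ℕ) → 1 ≤ w → WVertex → WEdge

  data WVertex : Set where
    white : List BEdge → WVertex

  data BEdge : Set where
    edge : (w : ℕ) → 1 ≤ w → BVertex → BEdge

WeightedTree : Set
WeightedTree = BVertex

mutual
  wsumW : List WEdge → ℕ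
  wsumW [] = 0
  wsumW (edge w _ _ ∷ es) = w + wsumW es

  wsumB : List BEdge → ℕ
  wsumB [] = 0
  wsumB (edge w _ _ ∷ es) = w + wsumB es

-- Black and white vertex degrees in a subtree, given the weight of the
-- edge to the parent (0 for the root, which has no parent edge).
mutual
  blacksB : ℕ → BVertex → List ℕ
  blacksB p (black es) = (p + wsumW es) ∷ blacksWs es

  blacksWs : List WEdge → List ℕ
  blacksWs [] = []
  blacksWs (edge w _ v ∷ es) = blacksW w v ++ blacksWs es

  blacksW : ℕ → WVertex → List ℕ
  blacksW p (white es) = blacksBs es

  blacksBs : List BEdge → List ℕ
  blacksBs [] = []
  blacksBs (edge w _ v ∷ es) = blacksB w v ++ blacksBs es

mutual
  whitesB : ℕ → BVertex → List ℕ
  whitesB p (black es) = whitesWs es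

  whitesWs : List WEdge → List ℕ
  whitesWs [] = []
  whitesWs (edge w _ v ∷ es) = whitesW w v ++ whitesWs es

  whitesW : ℕ → WVertex → List ℕ
  whitesW p (white es) = (p + wsumB es) ∷ whitesBs es

  whitesBs : List BEdge → List ℕ
  whitesBs [] = []
  whitesBs (edge w _ v ∷ es) = whitesB w v ++ whitesBs es

blackDegrees : WeightedTree → List ℕ
blackDegrees t = blacksB 0 t

whiteDegrees : WeightedTree → List ℕ
whiteDegrees t = whitesB 0 t

IsPartition : ℕ → List ℕ → Set
IsPartition n α = All (λ a → 1 ≤ a) α × sum α ≡ n

HasPassport : WeightedTree → List ℕ → List ℕ → Set
HasPassport t α β = blackDegrees t ↭ α × whiteDegrees t ↭ β

gcdList : List ℕ → ℕ
gcdList = foldr gcd 0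

{-# OPTIONS --safe #-}
-- A weighted tree with E edges has E + 1 vertices, and its total weight n, the sum of the black
-- degrees, is at least E since edge weights are positive; hence p + q ≤ n + 1.  Conversely, hanging
-- the smaller of the current black and white parts as a leaf on the larger one realizes any pair of
-- partitions of n by a forest with p + q − E trees.  Two of its trees can be glued into one, keeping
-- all degrees, as soon as an edge of one and an edge of the other have different weights.  Otherwise
-- all edges have a common weight c, which divides every part, so c = 1 by the gcd condition; then
-- E = n and the forest has p + q − n ≤ 1 trees.
module Submission where

open import Defs
open import Data.Empty using (⊥-elim)
open import Data.List using (List; []; _∷_; _++_; [_]; length; concatMap)
open import Data.List.Properties using (length-++; ++-assoc; ++-identityʳ)
open import Data.List.Relation.Binary.Permutation.Propositional
  using (_↭_; ↭-refl; ↭-sym; ↭-trans; ↭-reflexive; prep; module PermutationReasoning)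
open import Data.List.Relation.Binary.Permutation.Propositional.Properties
  using (shift; ++⁺ˡ; ++⁺ʳ; ↭-length; All-resp-↭; ↭-empty-inv; ++-commutativeMonoid)
  renaming (++-comm to ↭-++-comm)
open import Data.List.Relation.Unary.All as All using (All; []; _∷_)
import Data.List.Relation.Unary.All.Properties as AllP
open import Data.List.Relation.Unary.Any using (Any; here; there)
import Data.List.Relation.Unary.Any.Properties as Any
open import Data.Nat using (ℕ; suc; _+_; _∸_; _≤_; _<_; s≤s; z≤n)
open import Data.Nat.Divisibility using (_∣_; _∣0; ∣-refl; ∣m∣n⇒∣m+n; ∣1⇒≡1)
open import Data.Nat.GCD using (gcd-greatest)
open import Data.Nat.ListAction using (sum)
open import Data.Nat.ListAction.Properties using (sum-++; sum-↭)
open import Data.Nat.Properties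
  using (_≟_; <-cmp; <⇒≤; ≤-refl; ≤-trans; 1+n≰n; m<n⇒0<n∸m; m∸n+n≡m; m+[n∸m]≡n;
         +-suc; +-assoc; +-comm; +-identityʳ; +-mono-≤; +-cancelˡ-≡; +-cancelˡ-≤; +-commutativeSemigroup;
         module ≤-Reasoning)
open import Data.Product using (∃; _×_; _,_)
open import Data.Sum using (inj₁; inj₂)
open import Function.Bundles using (_⇔_; mk⇔)
open import Relation.Binary.Definitions using (tri<; tri≈; tri>)
open import Relation.Binary.PropositionalEquality
  using (_≡_; _≢_; refl; sym; trans; cong; cong₂; subst; module ≡-Reasoning)
open import Relation.Nullary using (yes; no)

open import Algebra.Solver.CommutativeMonoid (++-commutativeMonoid {A = ℕ}) using (solve; _⊜_; _⊕_)
open import Algebra.Properties.CommutativeSemigroup +-commutativeSemigroup using (interchange)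

mutual
  edgesB : BVertex → List ℕ
  edgesB (black es) = edgesWs es

  edgesW : WVertex → List ℕ
  edgesW (white bs) = edgesBs bs

  edgesWs : List WEdge → List ℕ
  edgesWs [] = []
  edgesWs (edge w _ v ∷ es) = w ∷ edgesW v ++ edgesWs es

  edgesBs : List BEdge → List ℕ
  edgesBs [] = []
  edgesBs (edge w _ v ∷ bs) = w ∷ edgesB v ++ edgesBs bs

length-++² : ∀ {A B : Set} (xs ys : List A) (xs′ ys′ : List B) →
  length (xs ++ ys) + length (xs′ ++ ys′) ≡ (length xs + length xs′) + (length ys + length ys′)
length-++² xs ys xs′ ys′ = begin
  length (xs ++ ys) + length (xs′ ++ ys′)              ≡⟨ cong₂ _+_ (length-++ xs) (length-++ xs′) ⟩
  (length xs + length ys) + (length xs′ + length ys′)  ≡⟨ interchange (length xs) _ _ _ ⟩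
  (length xs + length xs′) + (length ys + length ys′)  ∎
  where open ≡-Reasoning

mutual
  #vertices≡1+#edgesB : ∀ p v → length (blacksB p v) + length (whitesB p v) ≡ suc (length (edgesB v))
  #vertices≡1+#edgesB p (black es) = cong suc (#vertices≡#edgesWs es)

  #vertices≡1+#edgesW : ∀ p v → length (blacksW p v) + length (whitesW p v) ≡ suc (length (edgesW v))
  #vertices≡1+#edgesW p (white bs) = trans (+-suc _ _) (cong suc (#vertices≡#edgesBs bs))

  #vertices≡#edgesWs : ∀ es → length (blacksWs es) + length (whitesWs es) ≡ length (edgesWs es)
  #vertices≡#edgesWs [] = refl
  #vertices≡#edgesWs (edge w _ v ∷ es) = begin
    length (blacksW w v ++ blacksWs es) + length (whitesW w v ++ whitesWs es)
      ≡⟨ length-++² (blacksW w v) (blacksWs es) (whitesW w v) (whitesWs es) ⟩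
    (length (blacksW w v) + length (whitesW w v)) + (length (blacksWs es) + length (whitesWs es))
      ≡⟨ cong₂ _+_ (#vertices≡1+#edgesW w v) (#vertices≡#edgesWs es) ⟩
    suc (length (edgesW v) + length (edgesWs es))
      ≡⟨ cong suc (length-++ (edgesW v)) ⟨
    length (w ∷ edgesW v ++ edgesWs es) ∎
    where open ≡-Reasoning

  #vertices≡#edgesBs : ∀ bs → length (blacksBs bs) + length (whitesBs bs) ≡ length (edgesBs bs)
  #vertices≡#edgesBs [] = refl
  #vertices≡#edgesBs (edge w _ v ∷ bs) = begin
    length (blacksB w v ++ blacksBs bs) + length (whitesB w v ++ whitesBs bs)
      ≡⟨ length-++² (blacksB w v) (blacksBs bs) (whitesB w v) (whitesBs bs) ⟩
    (length (blacksB w v) + length (whitesB w v)) + (length (blacksBs bs) + length (whitesBs bs))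
      ≡⟨ cong₂ _+_ (#vertices≡1+#edgesB w v) (#vertices≡#edgesBs bs) ⟩
    suc (length (edgesB v) + length (edgesBs bs))
      ≡⟨ cong suc (length-++ (edgesB v)) ⟨
    length (w ∷ edgesB v ++ edgesBs bs) ∎
    where open ≡-Reasoning

mutual
  sum-blacksB : ∀ p v → sum (blacksB p v) ≡ p + sum (edgesB v)
  sum-blacksB p (black es) = trans (+-assoc p _ _) (cong (p +_) (sum-blacksWs es))

  sum-blacksW : ∀ p v → sum (blacksW p v) ≡ sum (edgesW v)
  sum-blacksW p (white bs) = sum-blacksBs bs

  sum-blacksWs : ∀ es → wsumW es + sum (blacksWs es) ≡ sum (edgesWs es)
  sum-blacksWs [] = refl
  sum-blacksWs (edge w _ v ∷ es) = begin
    (w + wsumW es) + sum (blacksW w v ++ blacksWs es)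
      ≡⟨ cong ((w + wsumW es) +_) (sum-++ (blacksW w v) _) ⟩
    (w + wsumW es) + (sum (blacksW w v) + sum (blacksWs es))
      ≡⟨ interchange w _ _ _ ⟩
    (w + sum (blacksW w v)) + (wsumW es + sum (blacksWs es))
      ≡⟨ +-assoc w _ _ ⟩
    w + (sum (blacksW w v) + (wsumW es + sum (blacksWs es)))
      ≡⟨ cong (w +_) (cong₂ _+_ (sum-blacksW w v) (sum-blacksWs es)) ⟩
    w + (sum (edgesW v) + sum (edgesWs es))
      ≡⟨ cong (w +_) (sum-++ (edgesW v) _) ⟨
    sum (w ∷ edgesW v ++ edgesWs es) ∎
    where open ≡-Reasoning

  sum-blacksBs : ∀ bs → sum (blacksBs bs) ≡ sum (edgesBs bs)
  sum-blacksBs [] = refl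
  sum-blacksBs (edge w _ v ∷ bs) = begin
    sum (blacksB w v ++ blacksBs bs)       ≡⟨ sum-++ (blacksB w v) _ ⟩
    sum (blacksB w v) + sum (blacksBs bs)  ≡⟨ cong₂ _+_ (sum-blacksB w v) (sum-blacksBs bs) ⟩
    (w + sum (edgesB v)) + sum (edgesBs bs) ≡⟨ +-assoc w _ _ ⟩
    w + (sum (edgesB v) + sum (edgesBs bs)) ≡⟨ cong (w +_) (sum-++ (edgesB v) _) ⟨
    sum (w ∷ edgesB v ++ edgesBs bs)       ∎
    where open ≡-Reasoning

mutual
  edges-positiveB : ∀ v → All (1 ≤_) (edgesB v)
  edges-positiveB (black es) = edges-positiveWs es

  edges-positiveW : ∀ v → All (1 ≤_) (edgesW v)
  edges-positiveW (white bs) = edges-positiveBs bs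

  edges-positiveWs : ∀ es → All (1 ≤_) (edgesWs es)
  edges-positiveWs [] = []
  edges-positiveWs (edge w 1≤w v ∷ es) = 1≤w ∷ AllP.++⁺ (edges-positiveW v) (edges-positiveWs es)

  edges-positiveBs : ∀ bs → All (1 ≤_) (edgesBs bs)
  edges-positiveBs [] = []
  edges-positiveBs (edge w 1≤w v ∷ bs) = 1≤w ∷ AllP.++⁺ (edges-positiveB v) (edges-positiveBs bs)

length≤sum : ∀ {xs} → All (1 ≤_) xs → length xs ≤ sum xs
length≤sum [] = z≤n
length≤sum (1≤x ∷ 1≤xs) = +-mono-≤ 1≤x (length≤sum 1≤xs)

passport-bound : ∀ t → length (blackDegrees t) + length (whiteDegrees t) ≤ suc (sum (blackDegrees t))
passport-bound t = begin
  length (blackDegrees t) + length (whiteDegrees t)  ≡⟨ #vertices≡1+#edgesB 0 t ⟩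
  suc (length (edgesB t))                            ≤⟨ s≤s (length≤sum (edges-positiveB t)) ⟩
  suc (sum (edgesB t))                               ≡⟨ cong suc (sum-blacksB 0 t) ⟨
  suc (sum (blackDegrees t))                         ∎
  where open ≤-Reasoning

module _ {P : ℕ → Set} (P0 : P 0) (P+ : ∀ {a b} → P a → P b → P (a + b)) where
  mutual
    degrees-closedB : ∀ p v → P p → All P (edgesB v) → All P (blacksB p v) × All P (whitesB p v)
    degrees-closedB p (black es) Pp Pes =
      let Pbl , Pwh , Pws = degrees-closedWs es Pes in P+ Pp Pws ∷ Pbl , Pwh

    degrees-closedW : ∀ p v → P p → All P (edgesW v) → All P (blacksW p v) × All P (whitesW p v)
    degrees-closedW p (white bs) Pp Pbs =
      let Pbl , Pwh , Pws = degrees-closedBs bs Pbs in Pbl , P+ Pp Pws ∷ Pwh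

    degrees-closedWs : ∀ es → All P (edgesWs es) → All P (blacksWs es) × All P (whitesWs es) × P (wsumW es)
    degrees-closedWs [] [] = [] , [] , P0
    degrees-closedWs (edge w _ v ∷ es) (Pw ∷ Pes) =
      let Pv , Pes′ = AllP.++⁻ (edgesW v) Pes
          Pbl , Pwh = degrees-closedW w v Pw Pv
          Pbl′ , Pwh′ , Pws = degrees-closedWs es Pes′
      in AllP.++⁺ Pbl Pbl′ , AllP.++⁺ Pwh Pwh′ , P+ Pw Pws

    degrees-closedBs : ∀ bs → All P (edgesBs bs) → All P (blacksBs bs) × All P (whitesBs bs) × P (wsumB bs)
    degrees-closedBs [] [] = [] , [] , P0
    degrees-closedBs (edge w _ v ∷ bs) (Pw ∷ Pbs) =
      let Pv , Pbs′ = AllP.++⁻ (edgesB v) Pbs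
          Pbl , Pwh = degrees-closedB w v Pw Pv
          Pbl′ , Pwh′ , Pws = degrees-closedBs bs Pbs′
      in AllP.++⁺ Pbl Pbl′ , AllP.++⁺ Pwh Pwh′ , P+ Pw Pws

Forest : Set
Forest = List WeightedTree

forestBlacks forestWhites forestEdges : Forest → List ℕ
forestBlacks = concatMap blackDegrees
forestWhites = concatMap whiteDegrees
forestEdges  = concatMap edgesB

Realizes : Forest → List ℕ → List ℕ → Set
Realizes F α β = forestBlacks F ↭ α × forestWhites F ↭ β

Realizes-resp-↭ : ∀ F {α α′ β β′} → α ↭ α′ → β ↭ β′ → Realizes F α β → Realizes F α′ β′
Realizes-resp-↭ F α↭α′ β↭β′ (Fα , Fβ) = ↭-trans Fα α↭α′ , ↭-trans Fβ β↭β′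

#vertices≡#edges+#trees : ∀ F →
  length (forestBlacks F) + length (forestWhites F) ≡ length (forestEdges F) + length F
#vertices≡#edges+#trees [] = refl
#vertices≡#edges+#trees (t ∷ F) = begin
  length (blackDegrees t ++ forestBlacks F) + length (whiteDegrees t ++ forestWhites F)
    ≡⟨ length-++² (blackDegrees t) (forestBlacks F) (whiteDegrees t) (forestWhites F) ⟩
  (length (blackDegrees t) + length (whiteDegrees t)) + (length (forestBlacks F) + length (forestWhites F))
    ≡⟨ cong₂ _+_ (#vertices≡1+#edgesB 0 t) (#vertices≡#edges+#trees F) ⟩
  suc (length (edgesB t) + (length (forestEdges F) + length F))
    ≡⟨ cong suc (+-assoc (length (edgesB t)) _ _) ⟨
  suc ((length (edgesB t) + length (forestEdges F)) + length F)
    ≡⟨ +-suc _ (length F) ⟨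
  (length (edgesB t) + length (forestEdges F)) + suc (length F)
    ≡⟨ cong (_+ suc (length F)) (length-++ (edgesB t)) ⟨
  length (edgesB t ++ forestEdges F) + suc (length F) ∎
  where open ≡-Reasoning

sum-forestBlacks : ∀ F → sum (forestBlacks F) ≡ sum (forestEdges F)
sum-forestBlacks [] = refl
sum-forestBlacks (t ∷ F) = begin
  sum (blackDegrees t ++ forestBlacks F)      ≡⟨ sum-++ (blackDegrees t) _ ⟩
  sum (blackDegrees t) + sum (forestBlacks F) ≡⟨ cong₂ _+_ (sum-blacksB 0 t) (sum-forestBlacks F) ⟩
  sum (edgesB t) + sum (forestEdges F)        ≡⟨ sum-++ (edgesB t) _ ⟨
  sum (edgesB t ++ forestEdges F)             ∎
  where open ≡-Reasoning

module _ {P : ℕ → Set} (P0 : P 0) (P+ : ∀ {a b} → P a → P b → P (a + b)) where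
  forestDegrees-closed : ∀ F → All P (forestEdges F) → All P (forestBlacks F) × All P (forestWhites F)
  forestDegrees-closed [] [] = [] , []
  forestDegrees-closed (t ∷ F) Pt∷F =
    let Pt , PF = AllP.++⁻ (edgesB t) Pt∷F
        Pbl , Pwh = degrees-closedB P0 P+ 0 t P0 Pt
        Pbl′ , Pwh′ = forestDegrees-closed F PF
    in AllP.++⁺ Pbl Pbl′ , AllP.++⁺ Pwh Pwh′

-- The greedy forest

∸-+-cancel : ∀ {a b} c → a ≤ b → (b ∸ a) + (a + c) ≡ b + c
∸-+-cancel {a} {b} c a≤b = trans (sym (+-assoc (b ∸ a) a c)) (cong (_+ c) (m∸n+n≡m a≤b))

∸-+-transpose : ∀ {a b x y} → a ≤ b → b + x ≡ a + y → (b ∸ a) + x ≡ y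
∸-+-transpose {a} {b} {x} {y} a≤b eq = +-cancelˡ-≡ a _ _ (begin
  a + ((b ∸ a) + x)  ≡⟨ +-assoc a _ x ⟨
  (a + (b ∸ a)) + x  ≡⟨ cong (_+ x) (m+[n∸m]≡n a≤b) ⟩
  b + x              ≡⟨ eq ⟩
  a + y              ∎)
  where open ≡-Reasoning

1≤m⇒m+n≢0 : ∀ {m n} → 1 ≤ m → m + n ≢ 0
1≤m⇒m+n≢0 (s≤s _) ()

leaf-shift : ∀ x xs ys → ((x + 0) ∷ xs) ++ ys ↭ xs ++ x ∷ ys
leaf-shift x xs ys = ↭-trans (↭-reflexive (cong (λ d → (d ∷ xs) ++ ys) (+-identityʳ x))) (↭-sym (shift x xs ys))

-- The vertex being grown is kept at the root: growBlack es r extends a black vertex with children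
-- es that still lacks weight r by the white parts β, hanging each part smaller than r on it as a
-- leaf and closing the tree with an equal one; a larger white part becomes the new root, with the
-- finished black vertex as its child.
mutual
  realize : ∀ α β → All (1 ≤_) α → All (1 ≤_) β → sum α ≡ sum β → ∃ λ F → Realizes F α β
  realize [] [] _ _ _ = [] , ↭-refl , ↭-refl
  realize [] (b ∷ β) _ (1≤b ∷ _) eq = ⊥-elim (1≤m⇒m+n≢0 1≤b (sym eq))
  realize (a ∷ α) β (1≤a ∷ α⁺) β⁺ eq =
    let F , R = growBlack [] a 1≤a α β α⁺ β⁺ eq
    in F , Realizes-resp-↭ F (↭-reflexive (cong (_∷ α) (+-identityʳ a))) ↭-refl R

  growBlack : ∀ es r → 1 ≤ r → ∀ α β → All (1 ≤_) α → All (1 ≤_) β → r + sum α ≡ sum β →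
    ∃ λ F → Realizes F ((r + wsumW es) ∷ blacksWs es ++ α) (whitesWs es ++ β)
  growBlack es r 1≤r α [] α⁺ β⁺ eq = ⊥-elim (1≤m⇒m+n≢0 1≤r eq)
  growBlack es r 1≤r α (b ∷ β) α⁺ (1≤b ∷ β⁺) eq with <-cmp b r
  ... | tri< b<r _ _ =
    let F , R = growBlack (edge b 1≤b (white []) ∷ es) (r ∸ b) (m<n⇒0<n∸m b<r) α β α⁺ β⁺
                  (∸-+-transpose (<⇒≤ b<r) eq)
    in F , Realizes-resp-↭ F
             (↭-reflexive (cong (λ d → d ∷ blacksWs es ++ α) (∸-+-cancel (wsumW es) (<⇒≤ b<r))))
             (leaf-shift b (whitesWs es) β)
             R
  ... | tri≈ _ refl _ =
    let F , Fα , Fβ = realize α β α⁺ β⁺ (+-cancelˡ-≡ b _ _ eq)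
    in black (edge b 1≤b (white []) ∷ es) ∷ F ,
       ++⁺ˡ ((b + wsumW es) ∷ blacksWs es) Fα ,
       ↭-trans (++⁺ˡ ((b + 0) ∷ whitesWs es) Fβ) (leaf-shift b (whitesWs es) β)
  ... | tri> _ _ r<b =
    let F , R = growWhite (edge r 1≤r (black es) ∷ []) (b ∸ r) (m<n⇒0<n∸m r<b) α β α⁺ β⁺
                  (sym (∸-+-transpose (<⇒≤ r<b) (sym eq)))
    in F , Realizes-resp-↭ F
             (↭-reflexive (cong (_++ α) (++-identityʳ ((r + wsumW es) ∷ blacksWs es))))
             (↭-trans (↭-reflexive (cong₂ (λ d xs → (d ∷ xs) ++ β)
                                           (∸-+-cancel 0 (<⇒≤ r<b)) (++-identityʳ (whitesWs es))))
                      (leaf-shift b (whitesWs es) β))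
             R

  growWhite : ∀ bs r → 1 ≤ r → ∀ α β → All (1 ≤_) α → All (1 ≤_) β → sum α ≡ r + sum β →
    ∃ λ F → Realizes F (blacksBs bs ++ α) ((r + wsumB bs) ∷ whitesBs bs ++ β)
  growWhite bs r 1≤r [] β α⁺ β⁺ eq = ⊥-elim (1≤m⇒m+n≢0 1≤r (sym eq))
  growWhite bs r 1≤r (a ∷ α) β (1≤a ∷ α⁺) β⁺ eq with <-cmp a r
  ... | tri< a<r _ _ =
    let F , R = growWhite (edge a 1≤a (black []) ∷ bs) (r ∸ a) (m<n⇒0<n∸m a<r) α β α⁺ β⁺
                  (sym (∸-+-transpose (<⇒≤ a<r) (sym eq)))
    in F , Realizes-resp-↭ F
             (leaf-shift a (blacksBs bs) α)
             (↭-reflexive (cong (λ d → d ∷ whitesBs bs ++ β) (∸-+-cancel (wsumB bs) (<⇒≤ a<r))))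
             R
  ... | tri≈ _ refl _ =
    let F , Fα , Fβ = realize α β α⁺ β⁺ (+-cancelˡ-≡ a _ _ eq)
    in black (edge a 1≤a (white bs) ∷ []) ∷ F ,
       ↭-trans (↭-reflexive (cong (λ xs → ((a + 0) ∷ xs) ++ forestBlacks F) (++-identityʳ (blacksBs bs))))
               (↭-trans (++⁺ˡ ((a + 0) ∷ blacksBs bs) Fα) (leaf-shift a (blacksBs bs) α)) ,
       ↭-trans (↭-reflexive (cong (_++ forestWhites F) (++-identityʳ ((a + wsumB bs) ∷ whitesBs bs))))
               (++⁺ˡ ((a + wsumB bs) ∷ whitesBs bs) Fβ)
  ... | tri> _ _ r<a =
    let F , R = growBlack (edge r 1≤r (white bs) ∷ []) (a ∸ r) (m<n⇒0<n∸m r<a) α β α⁺ β⁺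
                  (∸-+-transpose (<⇒≤ r<a) eq)
    in F , Realizes-resp-↭ F
             (↭-trans (↭-reflexive (cong₂ (λ d xs → (d ∷ xs) ++ α)
                                           (∸-+-cancel 0 (<⇒≤ r<a)) (++-identityʳ (blacksBs bs))))
                      (leaf-shift a (blacksBs bs) α))
             (↭-reflexive (cong (_++ β) (++-identityʳ ((r + wsumB bs) ∷ whitesBs bs))))
             R

-- Gluing two trees

+-∸-cancel : ∀ {a b} c → a ≤ b → a + ((b ∸ a) + c) ≡ b + c
+-∸-cancel {a} {b} c a≤b = trans (sym (+-assoc a (b ∸ a) c)) (cong (_+ c) (m+[n∸m]≡n a≤b))

++-extendˡ : ∀ {A : Set} (xs : List A) {ys ys′ zs} → ys′ ↭ ys ++ zs → xs ++ ys′ ↭ (xs ++ ys) ++ zs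
++-extendˡ xs ys′↭ = ↭-trans (++⁺ˡ xs ys′↭) (↭-reflexive (sym (++-assoc xs _ _)))

++-extendʳ : ∀ {A : Set} (xs ys : List A) {xs′ zs} → xs′ ↭ xs ++ zs → xs′ ++ ys ↭ (xs ++ ys) ++ zs
++-extendʳ xs ys {xs′} {zs} xs′↭ = begin
  xs′ ++ ys         ↭⟨ ++⁺ʳ ys xs′↭ ⟩
  (xs ++ zs) ++ ys  ≡⟨ ++-assoc xs zs ys ⟩
  xs ++ (zs ++ ys)  ↭⟨ ++⁺ˡ xs (↭-++-comm zs ys) ⟩
  xs ++ (ys ++ zs)  ≡⟨ ++-assoc xs ys zs ⟨
  (xs ++ ys) ++ zs  ∎
  where open PermutationReasoning

-- T₂ is glued onto an edge P–Q of weight x ≢ x₂ by joining P and Q to the ends w₂, b₂ of its root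
-- edge (each to the end of the other colour).  Both new edges get the smaller weight m of x and x₂,
-- the lighter of the two old edges is deleted and the heavier one loses m, so all degrees survive.
module Gluing (x₂ : ℕ) (1≤x₂ : 1 ≤ x₂) (cs₂ : List BEdge) (es₂ : List WEdge) where
  T₂ : WeightedTree
  T₂ = black (edge x₂ 1≤x₂ (white cs₂) ∷ es₂)

  degb₂ degw₂ : ℕ
  degb₂ = x₂ + wsumW es₂
  degw₂ = x₂ + wsumB cs₂

  GluedB : ℕ → BVertex → Set
  GluedB p v = ∃ λ v′ →
    blacksB p v′ ↭ blacksB p v ++ blackDegrees T₂ × whitesB p v′ ↭ whitesB p v ++ whiteDegrees T₂

  GluedW : ℕ → WVertex → Set
  GluedW p v = ∃ λ v′ →
    blacksW p v′ ↭ blacksW p v ++ blackDegrees T₂ × whitesW p v′ ↭ whitesW p v ++ whiteDegrees T₂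

  GluedWs : List WEdge → Set
  GluedWs es = ∃ λ es′ → wsumW es′ ≡ wsumW es ×
    blacksWs es′ ↭ blacksWs es ++ blackDegrees T₂ × whitesWs es′ ↭ whitesWs es ++ whiteDegrees T₂

  GluedBs : List BEdge → Set
  GluedBs bs = ∃ λ bs′ → wsumB bs′ ≡ wsumB bs ×
    blacksBs bs′ ↭ blacksBs bs ++ blackDegrees T₂ × whitesBs bs′ ↭ whitesBs bs ++ whiteDegrees T₂

  glueWs-lighter : ∀ x 1≤x ds es → x < x₂ → GluedWs (edge x 1≤x (white ds) ∷ es)
  glueWs-lighter x 1≤x ds es x<x₂ = edge x 1≤x (white (e ∷ cs₂)) ∷ es , refl ,
    ↭-trans (↭-reflexive (cong (λ d → ((d ∷ blacksBs ds ++ blacksWs es₂) ++ blacksBs cs₂) ++ blacksWs es)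
                               (∸-+-cancel (wsumW es₂) (<⇒≤ x<x₂))))
            (solve 5 (λ k d e c e₂ → ((k ⊕ (d ⊕ e₂)) ⊕ c) ⊕ e ⊜ (d ⊕ e) ⊕ (k ⊕ (c ⊕ e₂))) ↭-refl
                   [ degb₂ ] (blacksBs ds) (blacksWs es) (blacksBs cs₂) (blacksWs es₂)) ,
    ↭-trans (↭-reflexive (cong (λ d → (d ∷ (whitesW x (white ds) ++ whitesWs es₂) ++ whitesBs cs₂) ++ whitesWs es)
                               (+-∸-cancel (wsumB cs₂) (<⇒≤ x<x₂))))
            (solve 5 (λ l q e₂ c e → (l ⊕ ((q ⊕ e₂) ⊕ c)) ⊕ e ⊜ (q ⊕ e) ⊕ ((l ⊕ c) ⊕ e₂)) ↭-refl
                   [ degw₂ ] (whitesW x (white ds)) (whitesWs es₂) (whitesBs cs₂) (whitesWs es))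
    where
    e : BEdge
    e = edge (x₂ ∸ x) (m<n⇒0<n∸m x<x₂) (black (edge x 1≤x (white ds) ∷ es₂))

  glueWs-heavier : ∀ x 1≤x ds es → x₂ < x → GluedWs (edge x 1≤x (white ds) ∷ es)
  glueWs-heavier x 1≤x ds es x₂<x =
    edge (x ∸ x₂) (m<n⇒0<n∸m x₂<x) (white (edge x₂ 1≤x₂ (black es₂) ∷ ds)) ∷ edge x₂ 1≤x₂ (white cs₂) ∷ es ,
    ∸-+-cancel (wsumW es) (<⇒≤ x₂<x) ,
    solve 5 (λ k e₂ d c e → ((k ⊕ e₂) ⊕ d) ⊕ (c ⊕ e) ⊜ (d ⊕ e) ⊕ (k ⊕ (c ⊕ e₂))) ↭-refl
          [ degb₂ ] (blacksWs es₂) (blacksBs ds) (blacksBs cs₂) (blacksWs es) ,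
    ↭-trans (↭-reflexive (cong (λ d → (d ∷ whitesWs es₂ ++ whitesBs ds) ++ (degw₂ ∷ whitesBs cs₂) ++ whitesWs es)
                               (∸-+-cancel (wsumB ds) (<⇒≤ x₂<x))))
            (solve 5 (λ q e₂ d l e → (q ⊕ (e₂ ⊕ d)) ⊕ (l ⊕ e) ⊜ ((q ⊕ d) ⊕ e) ⊕ (l ⊕ e₂)) ↭-refl
                   [ x + wsumB ds ] (whitesWs es₂) (whitesBs ds) (degw₂ ∷ whitesBs cs₂) (whitesWs es))

  glueBs-lighter : ∀ x 1≤x fs bs → x < x₂ → GluedBs (edge x 1≤x (black fs) ∷ bs)
  glueBs-lighter x 1≤x fs bs x<x₂ = edge x 1≤x (black (e ∷ es₂)) ∷ bs , refl ,
    ↭-trans (↭-reflexive (cong (λ d → (d ∷ (blacksB x (black fs) ++ blacksBs cs₂) ++ blacksWs es₂) ++ blacksBs bs)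
                               (+-∸-cancel (wsumW es₂) (<⇒≤ x<x₂))))
            (solve 5 (λ k q c e₂ b → (k ⊕ ((q ⊕ c) ⊕ e₂)) ⊕ b ⊜ (q ⊕ b) ⊕ (k ⊕ (c ⊕ e₂))) ↭-refl
                   [ degb₂ ] (blacksB x (black fs)) (blacksBs cs₂) (blacksWs es₂) (blacksBs bs)) ,
    ↭-trans (↭-reflexive (cong (λ d → ((d ∷ whitesWs fs ++ whitesBs cs₂) ++ whitesWs es₂) ++ whitesBs bs)
                               (∸-+-cancel (wsumB cs₂) (<⇒≤ x<x₂))))
            (solve 5 (λ l f c e₂ b → ((l ⊕ (f ⊕ c)) ⊕ e₂) ⊕ b ⊜ (f ⊕ b) ⊕ ((l ⊕ c) ⊕ e₂)) ↭-refl
                   [ degw₂ ] (whitesWs fs) (whitesBs cs₂) (whitesWs es₂) (whitesBs bs))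
    where
    e : WEdge
    e = edge (x₂ ∸ x) (m<n⇒0<n∸m x<x₂) (white (edge x 1≤x (black fs) ∷ cs₂))

  glueBs-heavier : ∀ x 1≤x fs bs → x₂ < x → GluedBs (edge x 1≤x (black fs) ∷ bs)
  glueBs-heavier x 1≤x fs bs x₂<x =
    edge (x ∸ x₂) (m<n⇒0<n∸m x₂<x) (black (edge x₂ 1≤x₂ (white cs₂) ∷ fs)) ∷ edge x₂ 1≤x₂ (black es₂) ∷ bs ,
    ∸-+-cancel (wsumB bs) (<⇒≤ x₂<x) ,
    ↭-trans (↭-reflexive (cong (λ d → (d ∷ blacksBs cs₂ ++ blacksWs fs) ++ (degb₂ ∷ blacksWs es₂) ++ blacksBs bs)
                               (∸-+-cancel (wsumW fs) (<⇒≤ x₂<x))))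
            (solve 6 (λ q c f k e₂ b → (q ⊕ (c ⊕ f)) ⊕ ((k ⊕ e₂) ⊕ b) ⊜ ((q ⊕ f) ⊕ b) ⊕ (k ⊕ (c ⊕ e₂))) ↭-refl
                   [ x + wsumW fs ] (blacksBs cs₂) (blacksWs fs) [ degb₂ ] (blacksWs es₂) (blacksBs bs)) ,
    solve 4 (λ w f e₂ b → (w ⊕ f) ⊕ (e₂ ⊕ b) ⊜ (f ⊕ b) ⊕ (w ⊕ e₂)) ↭-refl
          (degw₂ ∷ whitesBs cs₂) (whitesWs fs) (whitesWs es₂) (whitesBs bs)

  mutual
    glueB : ∀ p v → Any (_≢ x₂) (edgesB v) → GluedB p v
    glueB p (black es) e≢x₂ =
      let es′ , ws , bl , wh = glueWs es e≢x₂
      in black es′ , ↭-trans (↭-reflexive (cong (λ w → (p + w) ∷ blacksWs es′) ws)) (prep (p + wsumW es) bl) , wh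

    glueW : ∀ p v → Any (_≢ x₂) (edgesW v) → GluedW p v
    glueW p (white bs) e≢x₂ =
      let bs′ , ws , bl , wh = glueBs bs e≢x₂
      in white bs′ , bl , ↭-trans (↭-reflexive (cong (λ w → (p + w) ∷ whitesBs bs′) ws)) (prep (p + wsumB bs) wh)

    glueWs : ∀ es → Any (_≢ x₂) (edgesWs es) → GluedWs es
    glueWs (edge x 1≤x (white ds) ∷ es) (here x≢x₂) with <-cmp x x₂
    ... | tri< x<x₂ _ _ = glueWs-lighter x 1≤x ds es x<x₂
    ... | tri≈ _ x≡x₂ _ = ⊥-elim (x≢x₂ x≡x₂)
    ... | tri> _ _ x₂<x = glueWs-heavier x 1≤x ds es x₂<x
    glueWs (edge x 1≤x v ∷ es) (there e≢x₂) with Any.++⁻ (edgesW v) e≢x₂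
    ... | inj₁ inV =
      let v′ , bl , wh = glueW x v inV
      in edge x 1≤x v′ ∷ es , refl ,
         ++-extendʳ (blacksW x v) (blacksWs es) bl , ++-extendʳ (whitesW x v) (whitesWs es) wh
    ... | inj₂ inEs =
      let es′ , ws , bl , wh = glueWs es inEs
      in edge x 1≤x v ∷ es′ , cong (x +_) ws , ++-extendˡ (blacksW x v) bl , ++-extendˡ (whitesW x v) wh

    glueBs : ∀ bs → Any (_≢ x₂) (edgesBs bs) → GluedBs bs
    glueBs (edge x 1≤x (black fs) ∷ bs) (here x≢x₂) with <-cmp x x₂
    ... | tri< x<x₂ _ _ = glueBs-lighter x 1≤x fs bs x<x₂
    ... | tri≈ _ x≡x₂ _ = ⊥-elim (x≢x₂ x≡x₂)
    ... | tri> _ _ x₂<x = glueBs-heavier x 1≤x fs bs x₂<x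
    glueBs (edge x 1≤x v ∷ bs) (there e≢x₂) with Any.++⁻ (edgesB v) e≢x₂
    ... | inj₁ inV =
      let v′ , bl , wh = glueB x v inV
      in edge x 1≤x v′ ∷ bs , refl ,
         ++-extendʳ (blacksB x v) (blacksBs bs) bl , ++-extendʳ (whitesB x v) (whitesBs bs) wh
    ... | inj₂ inBs =
      let bs′ , ws , bl , wh = glueBs bs inBs
      in edge x 1≤x v ∷ bs′ , cong (x +_) ws , ++-extendˡ (blacksB x v) bl , ++-extendˡ (whitesB x v) wh

  glueForest : ∀ F → Any (λ t → Any (_≢ x₂) (edgesB t)) F → ∃ λ F′ → length F′ ≡ length F ×
    Realizes F′ (forestBlacks F ++ blackDegrees T₂) (forestWhites F ++ whiteDegrees T₂)
  glueForest (t ∷ F) (here e≢x₂) =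
    let t′ , bl , wh = glueB 0 t e≢x₂
    in t′ ∷ F , refl ,
       ++-extendʳ (blackDegrees t) (forestBlacks F) bl , ++-extendʳ (whiteDegrees t) (forestWhites F) wh
  glueForest (t ∷ F) (there e≢x₂) =
    let F′ , #F′ , bl , wh = glueForest F e≢x₂
    in t ∷ F′ , cong suc #F′ , ++-extendˡ (blackDegrees t) bl , ++-extendˡ (whiteDegrees t) wh

-- Merging a forest into one tree

∣gcdList : ∀ {c xs} → All (c ∣_) xs → c ∣ gcdList xs
∣gcdList [] = _ ∣0
∣gcdList (c∣x ∷ c∣xs) = gcd-greatest c∣x (∣gcdList c∣xs)

sum-ones : ∀ {xs} → All (_≡ 1) xs → sum xs ≡ length xs
sum-ones [] = refl
sum-ones (refl ∷ ones) = cong suc (sum-ones ones)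

uniform⇒#trees≤1 : ∀ {c n α β} F → All (_≡ c) (forestEdges F) → Realizes F α β →
  sum α ≡ n → gcdList (α ++ β) ≡ 1 → length α + length β ≤ n + 1 → length F ≤ 1
uniform⇒#trees≤1 {c} {n} {α} {β} F uniform (Fα , Fβ) Σα gcd≡1 bound =
  +-cancelˡ-≤ #E (length F) 1 (begin
    #E + length F                                       ≡⟨ #vertices≡#edges+#trees F ⟨
    length (forestBlacks F) + length (forestWhites F)  ≡⟨ cong₂ _+_ (↭-length Fα) (↭-length Fβ) ⟩
    length α + length β                                 ≤⟨ bound ⟩
    n + 1                                               ≡⟨ cong (_+ 1) n≡#E ⟩
    #E + 1                                              ∎)
  where
  open ≤-Reasoning
  #E = length (forestEdges F)
  c∣degrees : All (c ∣_) (α ++ β)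
  c∣degrees =
    let c∣bl , c∣wh = forestDegrees-closed (c ∣0) ∣m∣n⇒∣m+n F
                        (All.map (λ x≡c → subst (c ∣_) (sym x≡c) ∣-refl) uniform)
    in AllP.++⁺ (All-resp-↭ Fα c∣bl) (All-resp-↭ Fβ c∣wh)
  c≡1 : c ≡ 1
  c≡1 = ∣1⇒≡1 (subst (c ∣_) gcd≡1 (∣gcdList c∣degrees))
  n≡#E : n ≡ #E
  n≡#E = begin-equality
    n                        ≡⟨ Σα ⟨
    sum α                    ≡⟨ sum-↭ Fα ⟨
    sum (forestBlacks F)     ≡⟨ sum-forestBlacks F ⟩
    sum (forestEdges F)      ≡⟨ sum-ones (subst (λ c → All (_≡ c) (forestEdges F)) c≡1 uniform) ⟩
    #E                       ∎

module Merging {n α β} (1≤n : 1 ≤ n) (α⁺ : All (1 ≤_) α) (Σα : sum α ≡ n) (gcd≡1 : gcdList (α ++ β) ≡ 1)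
               (bound : length α + length β ≤ n + 1) where

  merge-step : ∀ t₀ t₁ G → Realizes (t₀ ∷ t₁ ∷ G) α β → ∃ λ F′ → length F′ ≡ suc (length G) × Realizes F′ α β
  merge-step (black []) t₁ G (Fα , _) = ⊥-elim (1+n≰n (All.head (All-resp-↭ (↭-sym Fα) α⁺)))
  merge-step t₀ (black []) G (Fα , _) =
    ⊥-elim (1+n≰n (All.head (AllP.++⁻ʳ (blackDegrees t₀) (All-resp-↭ (↭-sym Fα) α⁺))))
  merge-step t₀@(black (edge x₂ 1≤x₂ (white cs₂) ∷ es₂)) t₁@(black (edge y 1≤y (white cs₁) ∷ es₁)) G (Fα , Fβ)
    with All.all? (_≟ x₂) (forestEdges (t₁ ∷ G))
  ... | no ¬uniform =
    let F′ , #F′ , R = Gluing.glueForest x₂ 1≤x₂ cs₂ es₂ (t₁ ∷ G)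
                         (Any.concatMap⁻ edgesB (AllP.¬All⇒Any¬ (_≟ x₂) _ ¬uniform))
    in F′ , #F′ , Realizes-resp-↭ F′ (↭-trans (↭-++-comm (forestBlacks (t₁ ∷ G)) (blackDegrees t₀)) Fα)
                                    (↭-trans (↭-++-comm (forestWhites (t₁ ∷ G)) (whiteDegrees t₀)) Fβ) R
  -- Now the root edge of t₁ weighs y ≡ x₂, so t₁ can be glued onto any edge of t₀ of another weight.
  ... | yes uniform with All.all? (_≟ x₂) (edgesB t₀)
  ...   | yes uniform₀ = ⊥-elim (1+n≰n (≤-trans (s≤s (s≤s z≤n))
          (uniform⇒#trees≤1 (t₀ ∷ t₁ ∷ G) (AllP.++⁺ uniform₀ uniform) (Fα , Fβ) Σα gcd≡1 bound)))
  ...   | no ¬uniform₀ =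
    let t₀′ , bl , wh = Gluing.glueB y 1≤y cs₁ es₁ 0 t₀
                          (subst (λ z → Any (_≢ z) (edgesB t₀)) (sym (All.head uniform))
                                 (AllP.¬All⇒Any¬ (_≟ x₂) _ ¬uniform₀))
    in t₀′ ∷ G , refl ,
       ↭-trans (++⁺ʳ (forestBlacks G) bl) (↭-trans (↭-reflexive (++-assoc (blackDegrees t₀) _ _)) Fα) ,
       ↭-trans (++⁺ʳ (forestWhites G) wh) (↭-trans (↭-reflexive (++-assoc (whiteDegrees t₀) _ _)) Fβ)

  merge-all : ∀ k F → length F ≤ k → Realizes F α β → ∃ λ t → HasPassport t α β
  merge-all _ [] _ (Fα , _) =
    ⊥-elim (1+n≰n (subst (1 ≤_) (trans (sym Σα) (cong sum (↭-empty-inv (↭-sym Fα)))) 1≤n))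
  merge-all _ (t ∷ []) _ (tα , tβ) =
    t , ↭-trans (↭-reflexive (sym (++-identityʳ _))) tα , ↭-trans (↭-reflexive (sym (++-identityʳ _))) tβ
  merge-all (suc k) (t₀ ∷ t₁ ∷ G) (s≤s #F≤k) R =
    let F′ , #F′ , R′ = merge-step t₀ t₁ G R in merge-all k F′ (subst (_≤ k) (sym #F′) #F≤k) R′

theorem3p3 : (n : ℕ) → 1 ≤ n → (α β : List ℕ) → IsPartition n α → IsPartition n β →
    gcdList (α ++ β) ≡ 1 →
    (∃ λ (t : WeightedTree) → HasPassport t α β) ⇔ (length α + length β ≤ n + 1)
theorem3p3 n 1≤n α β (α⁺ , Σα) (β⁺ , Σβ) gcd≡1 = mk⇔ only-if if
  where
  only-if : ∃ (λ t → HasPassport t α β) → length α + length β ≤ n + 1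
  only-if (t , tα , tβ) = begin
    length α + length β                                ≡⟨ cong₂ _+_ (↭-length tα) (↭-length tβ) ⟨
    length (blackDegrees t) + length (whiteDegrees t)  ≤⟨ passport-bound t ⟩
    suc (sum (blackDegrees t))                         ≡⟨ cong suc (trans (sum-↭ tα) Σα) ⟩
    suc n                                              ≡⟨ +-comm 1 n ⟩
    n + 1                                              ∎
    where open ≤-Reasoning

  if : length α + length β ≤ n + 1 → ∃ λ t → HasPassport t α β
  if bound =
    let F , R = realize α β α⁺ β⁺ (trans Σα (sym Σβ))
    in Merging.merge-all 1≤n α⁺ Σα gcd≡1 bound (length F) F ≤-refl R
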